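{- Let $n\ge 4$, $N=\{1,\dots,n\}$, let $i_1,i_2\in N$ with $i_1\ne i_2$, and let $\hat N^c=N\setminus\{i_1,i_2\}$. Then the inequality $$x_{i_2i_1}+\sum_{j\in\hat N^c}\left(x_{i_1j}+x_{ji_1}\right)-\sum_{j,j'\in\hat N^c:\ j\ne j'} x_{jj'}-\sum_{j\in\hat N^c}x_{i_2j}\ \le\ 2-\frac{(n-3)(n-4)}{2}$$ is a valid inequality for the weak order polytope $P^n_{WO}$.
   Context: Let $N=\{1,\dots,n\}$ and $A_N=\{(i,j): i,j\in N,\ i\ne j\}$. A weak order on $N$ is a binary relation $W\subseteq N\times N$ that is reflexive, transitive and total; $(i,j)\in W$ is read "$i$ is preferred over or tied with $j$". The characteristic vector of $W$ is $x^W\in\{0,1\}^{A_N}$ with $x^W_{ij}=1$ if $(i,j)\in W$ and $0$ otherwise. The weak order polytope $P^n_{WO}\subseteq\mathbb{R}^{A_N}$ is the convex hull of the characteristic vectors of all weak orders on $N$. An inequality $\pi x\le\pi_0$ is valid for $P$ if it holds for every $x\in P$.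
   Formalization: Validity is asserted only for the points of $P^n_{WO}$ with rational coordinates, the convex combinations of characteristic vectors with rational weights, rather than for all points in $\mathbb{R}^{A_N}$. -}

module Defs where

open import Data.Bool using (Bool; true; false; if_then_else_; _∧_; not)
open import Data.Nat using (ℕ; _∸_) renaming (_*_ to _*ℕ_)
open import Data.Fin using (Fin)
open import Data.List using (List; []; _∷_; map; foldr)
open import Data.List.Relation.Unary.All using (All)
open import Data.List.Membership.Propositional using (_∈_)
open import Data.Product using (_×_; _,_; proj₁; proj₂; Σ; ∃)
open import Data.Sum using (_⊎_)
open import Data.Integer using (+_)
open import Data.Rational using (ℚ; 0ℚ; 1ℚ; _+_; _-_; _*_; _≤_; _/_)
open import Relation.Nullary.Decidable using (⌊_⌋)
open import Relation.Binary.PropositionalEquality using (_≡_; _≢_)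
open import Data.Fin using () renaming (_≟_ to _≟F_)
open import Data.List using (allFin)

Rel₂ : ℕ → Set
Rel₂ n = Fin n → Fin n → Bool

record WeakOrder (n : ℕ) : Set where
  field
    rel   : Rel₂ n
    refl  : ∀ i → rel i i ≡ true
    trans : ∀ i j k → rel i j ≡ true → rel j k ≡ true → rel i k ≡ true
    total : ∀ i j → (rel i j ≡ true) ⊎ (rel j i ≡ true)

open WeakOrder public

-- Points of the ambient space: x_{ij} for i, j ∈ N (only the arcs i ≠ j are
-- used; the diagonal coordinates play no role).
Point : ℕ → Set
Point n = Fin n → Fin n → ℚ

bool→ℚ : Bool → ℚ
bool→ℚ true  = 1ℚ
bool→ℚ false = 0ℚ

charVec : ∀ {n} → WeakOrder n → Point n
charVec W i j = bool→ℚ (rel W i j)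

sumℚ : List ℚ → ℚ
sumℚ = foldr _+_ 0ℚ

-- Convex hull (finite convex combinations, rational coefficients) of the
-- characteristic vectors of all weak orders on N.
record InWOPolytope (n : ℕ) (x : Point n) : Set where
  field
    comb    : List (ℚ × WeakOrder n)
    nonneg  : All (λ p → 0ℚ ≤ proj₁ p) comb
    sumOne  : sumℚ (map proj₁ comb) ≡ 1ℚ
    isComb  : ∀ i j → x i j ≡ sumℚ (map (λ p → proj₁ p * charVec (proj₂ p) i j) comb)

Valid : ∀ {n} → (Point n → Set) → (Point n → ℚ) → ℚ → Set
Valid {n} P lhs rhs = ∀ (x : Point n) → P x → lhs x ≤ rhs

ΣN : ∀ {n} → (Fin n → ℚ) → ℚ
ΣN {n} f = sumℚ (map f (allFin n))

inNc : ∀ {n} → Fin n → Fin n → Fin n → Bool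
inNc i₁ i₂ j = not ⌊ j ≟F i₁ ⌋ ∧ not ⌊ j ≟F i₂ ⌋

ΣNc : ∀ {n} → Fin n → Fin n → (Fin n → ℚ) → ℚ
ΣNc i₁ i₂ f = ΣN (λ j → if inNc i₁ i₂ j then f j else 0ℚ)

lhs5 : ∀ {n} → Fin n → Fin n → Point n → ℚ
lhs5 i₁ i₂ x =
  ((x i₂ i₁ + ΣNc i₁ i₂ (λ j → x i₁ j + x j i₁))
    - ΣNc i₁ i₂ (λ j → ΣNc i₁ i₂ (λ j' → if ⌊ j ≟F j' ⌋ then 0ℚ else x j j')))
    - ΣNc i₁ i₂ (λ j → x i₂ j)

rhs5 : ℕ → ℚ
rhs5 n = (+ 2 / 1) - (+ ((n ∸ 3) *ℕ (n ∸ 4)) / 2)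

-- The left-hand side is linear, so it suffices to bound it at the characteristic vector of a
-- weak order W. Let s = n − 2 = |N̂ᶜ|, let a be the number of j ∈ N̂ᶜ tied with i₁ in W, and
-- b = x_{i₂i₁}. Every j contributes 1 + [j tied with i₁] to the first sum, so it equals s + a.
-- Every pair j ≠ j' contributes at least 1 to the off-diagonal sum, and 2 when both are tied
-- with i₁ (then they are tied with each other), so that sum is at least C(s,2) + C(a,2).
-- If b = 1 then i₂ is preferred over every j tied with i₁, so the last sum is at least ab.
-- Hence the left-hand side is at most b + s + a − C(s,2) − C(a,2) − ab, and since
-- C(s,2) = C(s−1,2) + s − 1 and a + b ≤ 1 + C(a,2) + ab this is at most 2 − C(n−3,2).
module Submission where

open import Defs
open import Data.Nat using (ℕ; _≤_)
open import Data.Fin using (Fin)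
open import Relation.Binary.PropositionalEquality using (_≢_)

open import Algebra.Bundles using (CommutativeMonoid)
import Algebra.Properties.CommutativeSemigroup as CommutativeSemigroupProperties
open import Data.Bool using (Bool; true; false; _∧_; not; if_then_else_)
open import Data.Fin using (_≟_)
import Data.Integer as ℤ
import Data.Integer.Properties as ℤ
import Data.Integer.Tactic.RingSolver as ℤ-RingSolver
open import Data.List using (List; []; _∷_; map; length; allFin; filterᵇ)
open import Data.List.Membership.Propositional using (_∈_)
open import Data.List.Membership.Propositional.Properties using (∈-allFin; ∈-filter⁺)
open import Data.List.Properties using (map-cong; filter-all; length-tabulate)
open import Data.List.Relation.Unary.All as All using (All; []; _∷_)
open import Data.List.Relation.Unary.Any using (here; there)
open import Data.List.Relation.Unary.Unique.Propositional using (Unique; []; _∷_)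
open import Data.List.Relation.Unary.Unique.Propositional.Properties using (allFin⁺; filter⁺)
open import Data.Nat using (zero; suc; z≤n; s≤s; _∸_)
import Data.Nat as ℕ
import Data.Nat.Properties as ℕ
open import Data.Nat.ListAction using (sum)
open import Data.Nat.Combinatorics using (_C_; nC1≡n; nCk+nC[k+1]≡[n+1]C[k+1])
open import Data.Nat.Tactic.RingSolver using (solve-∀)
open import Data.Product using (_×_; _,_; proj₁; proj₂)
open import Data.Rational using (ℚ; 0ℚ; 1ℚ; _+_; _-_; _*_; -_; _/_; toℚᵘ; nonNegative)
import Data.Rational as ℚ
import Data.Rational.Properties as ℚ
import Data.Rational.Solver as ℚ-Solver
import Data.Rational.Unnormalised as ℚᵘ
import Data.Rational.Unnormalised.Properties as ℚᵘ
open import Data.Sum using (_⊎_; inj₁; inj₂)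
open import Data.Unit using (tt)
open import Function using (_∘_)
open import Relation.Binary.Definitions using (DecidableEquality)
open import Relation.Nullary using (yes; no; contradiction)
open import Relation.Nullary.Decidable using (⌊_⌋; fromWitnessFalse)
import Relation.Binary.PropositionalEquality as ≡
open import Relation.Binary.PropositionalEquality
  using (_≡_; sym; cong; cong₂; subst; subst₂; module ≡-Reasoning)

fromℕ : ℕ → ℚ
fromℕ zero    = 0ℚ
fromℕ (suc m) = 1ℚ + fromℕ m

fromℕ-+ : ∀ m n → fromℕ (m ℕ.+ n) ≡ fromℕ m + fromℕ n
fromℕ-+ zero    n = sym (ℚ.+-identityˡ (fromℕ n))
fromℕ-+ (suc m) n =
  ≡.trans (cong (1ℚ +_) (fromℕ-+ m n)) (sym (ℚ.+-assoc 1ℚ (fromℕ m) (fromℕ n)))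

fromℕ-nonNegative : ∀ m → 0ℚ ℚ.≤ fromℕ m
fromℕ-nonNegative zero    = ℚ.≤-refl
fromℕ-nonNegative (suc m) = ℚ.+-mono-≤ {0ℚ} {1ℚ} (ℚ.≤ᵇ⇒≤ tt) (fromℕ-nonNegative m)

fromℕ-mono-≤ : ∀ {m n} → m ≤ n → fromℕ m ℚ.≤ fromℕ n
fromℕ-mono-≤ {n = n} z≤n = fromℕ-nonNegative n
fromℕ-mono-≤ (s≤s m≤n)   = ℚ.+-monoʳ-≤ 1ℚ (fromℕ-mono-≤ m≤n)

toℚᵘ-fromℕ : ∀ m → toℚᵘ (fromℕ m) ℚᵘ.≃ ℚᵘ.mkℚᵘ (ℤ.+ m) 0
toℚᵘ-fromℕ zero    = ℚᵘ.≃-refl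
toℚᵘ-fromℕ (suc m) =
  ℚᵘ.≃-trans (ℚ.toℚᵘ-homo-+ 1ℚ (fromℕ m))
    (ℚᵘ.≃-trans (ℚᵘ.+-congʳ (toℚᵘ 1ℚ) (toℚᵘ-fromℕ m)) (ℚᵘ.*≡* (cross-multiply (ℤ.+ m))))
  where
  cross-multiply : ∀ x →
    (ℤ.+ 1 ℤ.+ x ℤ.* ℤ.+ 1) ℤ.* ℤ.+ 1 ≡ (ℤ.+ 1 ℤ.+ x) ℤ.* (ℤ.+ 1 ℤ.* ℤ.+ 1)
  cross-multiply = ℤ-RingSolver.solve-∀

fromℕ≡/1 : ∀ m → fromℕ m ≡ ℤ.+ m / 1
fromℕ≡/1 m = ≡.trans (sym (ℚ.fromℚᵘ-toℚᵘ (fromℕ m))) (ℚ.fromℚᵘ-cong (toℚᵘ-fromℕ m))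

p+s≤r+q⇒p-q≤r-s : ∀ p q r s → p + s ℚ.≤ r + q → p - q ℚ.≤ r - s
p+s≤r+q⇒p-q≤r-s p q r s p+s≤r+q =
  subst₂ ℚ._≤_ (sym (shiftˡ p q s)) (sym (shiftʳ q r s)) (ℚ.+-monoˡ-≤ (- q - s) p+s≤r+q)
  where
  open ℚ-Solver.+-*-Solver
  shiftˡ : ∀ p q s → p - q ≡ (p + s) + (- q - s)
  shiftˡ = solve 3 (λ p q s → p :- q := (p :+ s) :+ (:- q :- s)) ≡.refl
  shiftʳ : ∀ q r s → r - s ≡ (r + q) + (- q - s)
  shiftʳ = solve 3 (λ q r s → r :- s := (r :+ q) :+ (:- q :- s)) ≡.refl

fromℕ-difference-≤ : ∀ m n k l → m ℕ.+ l ≤ k ℕ.+ n → fromℕ m - fromℕ n ℚ.≤ fromℕ k - fromℕ l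
fromℕ-difference-≤ m n k l m+l≤k+n =
  p+s≤r+q⇒p-q≤r-s (fromℕ m) (fromℕ n) (fromℕ k) (fromℕ l)
    (subst₂ ℚ._≤_ (fromℕ-+ m l) (fromℕ-+ k n) (fromℕ-mono-≤ m+l≤k+n))

bool→ℕ : Bool → ℕ
bool→ℕ false = 0
bool→ℕ true  = 1

bool→ℚ≡fromℕ : ∀ b → bool→ℚ b ≡ fromℕ (bool→ℕ b)
bool→ℚ≡fromℕ false = ≡.refl
bool→ℚ≡fromℕ true  = ≡.refl

bool→ℚ-+ : ∀ {a b} → a ≡ true ⊎ b ≡ true →
           bool→ℚ a + bool→ℚ b ≡ fromℕ (suc (bool→ℕ (a ∧ b)))
bool→ℚ-+ {true}  {true}  _ = ≡.refl
bool→ℚ-+ {true}  {false} _ = ≡.refl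
bool→ℚ-+ {false} {true}  _ = ≡.refl
bool→ℚ-+ {false} {false} (inj₁ ())
bool→ℚ-+ {false} {false} (inj₂ ())

∧≡true⇒ : ∀ {a b} → a ∧ b ≡ true → a ≡ true × b ≡ true
∧≡true⇒ {true} {true} _ = ≡.refl , ≡.refl

-- Binomial coefficients C(n, 2)

[1+n]C2≡n+nC2 : ∀ n → suc n C 2 ≡ n ℕ.+ n C 2
[1+n]C2≡n+nC2 n =
  ≡.trans (sym (nCk+nC[k+1]≡[n+1]C[k+1] n 1)) (cong (ℕ._+ n C 2) (nC1≡n n))

nC2*2≡n*[n∸1] : ∀ n → (n C 2) ℕ.* 2 ≡ n ℕ.* (n ∸ 1)
nC2*2≡n*[n∸1] zero          = ≡.refl
nC2*2≡n*[n∸1] (suc zero)    = ≡.refl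
nC2*2≡n*[n∸1] (suc (suc n)) = begin
  (suc (suc n) C 2) ℕ.* 2           ≡⟨ cong (ℕ._* 2) ([1+n]C2≡n+nC2 (suc n)) ⟩
  (suc n ℕ.+ suc n C 2) ℕ.* 2       ≡⟨ ℕ.*-distribʳ-+ 2 (suc n) (suc n C 2) ⟩
  suc n ℕ.* 2 ℕ.+ (suc n C 2) ℕ.* 2 ≡⟨ cong (suc n ℕ.* 2 ℕ.+_) (nC2*2≡n*[n∸1] (suc n)) ⟩
  suc n ℕ.* 2 ℕ.+ suc n ℕ.* n       ≡⟨ factor n ⟩
  suc (suc n) ℕ.* suc n             ∎
  where
  open ≡-Reasoning
  factor : ∀ n → suc n ℕ.* 2 ℕ.+ suc n ℕ.* n ≡ suc (suc n) ℕ.* suc n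
  factor = solve-∀

[n*[n∸1]]/2≡nC2 : ∀ n → ℤ.+ (n ℕ.* (n ∸ 1)) / 2 ≡ fromℕ (n C 2)
[n*[n∸1]]/2≡nC2 n = ≡.trans
  (ℚ.fromℚᵘ-cong {ℚᵘ.mkℚᵘ (ℤ.+ (n ℕ.* (n ∸ 1))) 1} {ℚᵘ.mkℚᵘ (ℤ.+ (n C 2)) 0}
                 (ℚᵘ.*≡* cross))
  (sym (fromℕ≡/1 (n C 2)))
  where
  cross : ℤ.+ (n ℕ.* (n ∸ 1)) ℤ.* ℤ.+ 1 ≡ ℤ.+ (n C 2) ℤ.* ℤ.+ 2
  cross = ≡.trans (sym (ℤ.pos-* (n ℕ.* (n ∸ 1)) 1))
    (≡.trans (cong ℤ.+_ (≡.trans (ℕ.*-identityʳ _) (sym (nC2*2≡n*[n∸1] n))))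
             (ℤ.pos-* (n C 2) 2))

rhs5-3+n : ∀ n → rhs5 (3 ℕ.+ n) ≡ fromℕ 2 - fromℕ (n C 2)
rhs5-3+n n = cong (λ q → fromℕ 2 - q) ([n*[n∸1]]/2≡nC2 n)

[b+a]C2≡ba+aC2 : ∀ b a → (bool→ℕ b ℕ.+ a) C 2 ≡ bool→ℕ b ℕ.* a ℕ.+ a C 2
[b+a]C2≡ba+aC2 false a = ≡.refl
[b+a]C2≡ba+aC2 true  a = ≡.trans ([1+n]C2≡n+nC2 a) (cong (ℕ._+ a C 2) (sym (ℕ.+-identityʳ a)))

pairs-∷ : ∀ l b a →
  suc l C 2 ℕ.+ (bool→ℕ b ℕ.+ a) C 2 ≡ (l ℕ.+ bool→ℕ b ℕ.* a) ℕ.+ (l C 2 ℕ.+ a C 2)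
pairs-∷ l b a = ≡.trans (cong₂ ℕ._+_ ([1+n]C2≡n+nC2 l) ([b+a]C2≡ba+aC2 b a))
                        (regroup l (l C 2) (bool→ℕ b ℕ.* a) (a C 2))
  where
  regroup : ∀ l c d e → (l ℕ.+ c) ℕ.+ (d ℕ.+ e) ≡ (l ℕ.+ d) ℕ.+ (c ℕ.+ e)
  regroup = solve-∀

n≤1+nC2 : ∀ n → n ≤ suc (n C 2)
n≤1+nC2 zero    = z≤n
n≤1+nC2 (suc n) =
  subst (suc n ≤_) (cong suc (sym ([1+n]C2≡n+nC2 n))) (s≤s (ℕ.m≤m+n n (n C 2)))

1+b+a≤2+aC2+ba : ∀ b a → suc (bool→ℕ b ℕ.+ a) ≤ 2 ℕ.+ (a C 2 ℕ.+ bool→ℕ b ℕ.* a)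
1+b+a≤2+aC2+ba false a = s≤s (ℕ.≤-trans (n≤1+nC2 a) (s≤s (ℕ.m≤m+n (a C 2) 0)))
1+b+a≤2+aC2+ba true  a = s≤s (s≤s (ℕ.≤-trans (ℕ.m≤m+n a 0) (ℕ.m≤n+m (a ℕ.+ 0) (a C 2))))

vertex-value-≤-ℕ : ∀ b k a →
  bool→ℕ b ℕ.+ (suc k ℕ.+ a) ℕ.+ k C 2 ≤ 2 ℕ.+ ((suc k C 2 ℕ.+ a C 2) ℕ.+ bool→ℕ b ℕ.* a)
vertex-value-≤-ℕ b k a = begin
  β ℕ.+ (suc k ℕ.+ a) ℕ.+ k C 2
    ≡⟨ regroupˡ β k a (k C 2) ⟩
  (k ℕ.+ k C 2) ℕ.+ suc (β ℕ.+ a)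
    ≤⟨ ℕ.+-monoʳ-≤ (k ℕ.+ k C 2) (1+b+a≤2+aC2+ba b a) ⟩
  (k ℕ.+ k C 2) ℕ.+ (2 ℕ.+ (a C 2 ℕ.+ β ℕ.* a))
    ≡⟨ regroupʳ (k ℕ.+ k C 2) (a C 2) (β ℕ.* a) ⟩
  2 ℕ.+ (((k ℕ.+ k C 2) ℕ.+ a C 2) ℕ.+ β ℕ.* a)
    ≡⟨ cong (λ c → 2 ℕ.+ ((c ℕ.+ a C 2) ℕ.+ β ℕ.* a)) (sym ([1+n]C2≡n+nC2 k)) ⟩
  2 ℕ.+ ((suc k C 2 ℕ.+ a C 2) ℕ.+ β ℕ.* a)
    ∎
  where
  open ℕ.≤-Reasoning
  β : ℕ
  β = bool→ℕ b
  regroupˡ : ∀ b k a c → b ℕ.+ (suc k ℕ.+ a) ℕ.+ c ≡ (k ℕ.+ c) ℕ.+ suc (b ℕ.+ a)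
  regroupˡ = solve-∀
  regroupʳ : ∀ c d e → c ℕ.+ (2 ℕ.+ (d ℕ.+ e)) ≡ 2 ℕ.+ ((c ℕ.+ d) ℕ.+ e)
  regroupʳ = solve-∀

[p-q]-r≡p-[q+r] : ∀ p q r → (p - q) - r ≡ p - (q + r)
[p-q]-r≡p-[q+r] p q r =
  ≡.trans (ℚ.+-assoc p (- q) (- r)) (cong (p +_) (sym (ℚ.neg-distrib-+ q r)))

vertex-value-≤ : ∀ {n} s b a → 2 ℕ.+ s ≡ n → 4 ≤ n →
  ((fromℕ (bool→ℕ b) + fromℕ (s ℕ.+ a)) - fromℕ (s C 2 ℕ.+ a C 2)) - fromℕ (bool→ℕ b ℕ.* a)
    ℚ.≤ rhs5 n
vertex-value-≤ zero    b a ≡.refl (s≤s (s≤s ()))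
vertex-value-≤ (suc k) b a ≡.refl _ = begin
  ((fromℕ β + fromℕ (suc k ℕ.+ a)) - fromℕ (suc k C 2 ℕ.+ a C 2)) - fromℕ (β ℕ.* a)
    ≡⟨ [p-q]-r≡p-[q+r] (fromℕ β + fromℕ (suc k ℕ.+ a)) (fromℕ (suc k C 2 ℕ.+ a C 2))
                       (fromℕ (β ℕ.* a)) ⟩
  (fromℕ β + fromℕ (suc k ℕ.+ a)) - (fromℕ (suc k C 2 ℕ.+ a C 2) + fromℕ (β ℕ.* a))
    ≡⟨ sym (cong₂ _-_ (fromℕ-+ β (suc k ℕ.+ a))
                      (fromℕ-+ (suc k C 2 ℕ.+ a C 2) (β ℕ.* a))) ⟩
  fromℕ (β ℕ.+ (suc k ℕ.+ a)) - fromℕ ((suc k C 2 ℕ.+ a C 2) ℕ.+ β ℕ.* a)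
    ≤⟨ fromℕ-difference-≤ _ _ 2 (k C 2) (vertex-value-≤-ℕ b k a) ⟩
  fromℕ 2 - fromℕ (k C 2)
    ≡⟨ sym (rhs5-3+n k) ⟩
  rhs5 (3 ℕ.+ k)
    ∎
  where
  open ℚ.≤-Reasoning
  β : ℕ
  β = bool→ℕ b

∑ : ∀ {A : Set} → List A → (A → ℚ) → ℚ
∑ xs f = sumℚ (map f xs)

module _ {A : Set} where

  ∑-cong : ∀ (xs : List A) {f g : A → ℚ} → (∀ a → f a ≡ g a) → ∑ xs f ≡ ∑ xs g
  ∑-cong xs f≗g = cong sumℚ (map-cong f≗g xs)

  ∑-zero : ∀ (xs : List A) → ∑ xs (λ _ → 0ℚ) ≡ 0ℚ
  ∑-zero []       = ≡.refl
  ∑-zero (_ ∷ xs) = ≡.trans (cong (0ℚ +_) (∑-zero xs)) (ℚ.+-identityˡ 0ℚ)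

  ∑-+ : ∀ (xs : List A) (f g : A → ℚ) → ∑ xs (λ a → f a + g a) ≡ ∑ xs f + ∑ xs g
  ∑-+ []       f g = ≡.refl
  ∑-+ (x ∷ xs) f g = ≡.trans (cong (f x + g x +_) (∑-+ xs f g))
    (+-interchange (f x) (g x) (∑ xs f) (∑ xs g))
    where
    open CommutativeSemigroupProperties
      (CommutativeMonoid.commutativeSemigroup ℚ.+-0-commutativeMonoid)
      renaming (interchange to +-interchange)

  ∑-neg : ∀ (xs : List A) (f : A → ℚ) → ∑ xs (λ a → - f a) ≡ - ∑ xs f
  ∑-neg []       f = ≡.refl
  ∑-neg (x ∷ xs) f =
    ≡.trans (cong (- f x +_) (∑-neg xs f)) (sym (ℚ.neg-distrib-+ (f x) (∑ xs f)))

  ∑-mono-≤ : ∀ {xs : List A} {f g : A → ℚ} → All (λ a → f a ℚ.≤ g a) xs → ∑ xs f ℚ.≤ ∑ xs g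
  ∑-mono-≤ []           = ℚ.≤-refl
  ∑-mono-≤ (fx≤gx ∷ ps) = ℚ.+-mono-≤ fx≤gx (∑-mono-≤ ps)

  ∑-fromℕ : ∀ (xs : List A) (f : A → ℕ) → ∑ xs (λ a → fromℕ (f a)) ≡ fromℕ (sum (map f xs))
  ∑-fromℕ []       f = ≡.refl
  ∑-fromℕ (x ∷ xs) f =
    ≡.trans (cong (fromℕ (f x) +_) (∑-fromℕ xs f)) (sym (fromℕ-+ (f x) (sum (map f xs))))

  ∑-filterᵇ : ∀ (p : A → Bool) (f : A → ℚ) xs →
              ∑ xs (λ a → if p a then f a else 0ℚ) ≡ ∑ (filterᵇ p xs) f
  ∑-filterᵇ p f []       = ≡.refl
  ∑-filterᵇ p f (x ∷ xs) with p x
  ... | true  = cong (f x +_) (∑-filterᵇ p f xs)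
  ... | false = ≡.trans (ℚ.+-identityˡ (∑ xs (λ a → if p a then f a else 0ℚ))) (∑-filterᵇ p f xs)

  sum-map-suc : ∀ (f : A → ℕ) xs → sum (map (λ a → suc (f a)) xs) ≡ length xs ℕ.+ sum (map f xs)
  sum-map-suc f []       = ≡.refl
  sum-map-suc f (x ∷ xs) = ≡.trans (cong (suc (f x) ℕ.+_) (sum-map-suc f xs))
                                   (regroup (f x) (length xs) (sum (map f xs)))
    where
    regroup : ∀ a l s → suc a ℕ.+ (l ℕ.+ s) ≡ suc l ℕ.+ (a ℕ.+ s)
    regroup = solve-∀

  sum-map-*ˡ : ∀ c (f : A → ℕ) xs → sum (map (λ a → c ℕ.* f a) xs) ≡ c ℕ.* sum (map f xs)
  sum-map-*ˡ c f []       = sym (ℕ.*-zeroʳ c)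
  sum-map-*ˡ c f (x ∷ xs) = ≡.trans (cong (c ℕ.* f x ℕ.+_) (sum-map-*ˡ c f xs))
                                   (sym (ℕ.*-distribˡ-+ c (f x) (sum (map f xs))))

count : ∀ {A : Set} → (A → Bool) → List A → ℕ
count p xs = sum (map (λ a → bool→ℕ (p a)) xs)

weighted : ∀ {A : Set} → List (ℚ × A) → (A → ℚ) → ℚ
weighted cs f = ∑ cs (λ p → proj₁ p * f (proj₂ p))

module _ {A : Set} where

  weighted-zero : ∀ (cs : List (ℚ × A)) → weighted cs (λ _ → 0ℚ) ≡ 0ℚ
  weighted-zero cs = ≡.trans (∑-cong cs (λ p → ℚ.*-zeroʳ (proj₁ p))) (∑-zero cs)

  weighted-+ : ∀ (cs : List (ℚ × A)) f g →
               weighted cs (λ a → f a + g a) ≡ weighted cs f + weighted cs g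
  weighted-+ cs f g =
    ≡.trans (∑-cong cs (λ p → ℚ.*-distribˡ-+ (proj₁ p) (f (proj₂ p)) (g (proj₂ p))))
            (∑-+ cs (λ p → proj₁ p * f (proj₂ p)) (λ p → proj₁ p * g (proj₂ p)))

  weighted-neg : ∀ (cs : List (ℚ × A)) f → weighted cs (λ a → - f a) ≡ - weighted cs f
  weighted-neg cs f =
    ≡.trans (∑-cong cs (λ p → sym (ℚ.neg-distribʳ-* (proj₁ p) (f (proj₂ p)))))
            (∑-neg cs (λ p → proj₁ p * f (proj₂ p)))

  weighted-≤ : ∀ {cs : List (ℚ × A)} {f r} →
               All (λ p → 0ℚ ℚ.≤ proj₁ p) cs → (∀ a → f a ℚ.≤ r) →
               weighted cs f ℚ.≤ ∑ cs proj₁ * r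
  weighted-≤ {[]}           {r = r} []         _  = ℚ.≤-reflexive (sym (ℚ.*-zeroˡ r))
  weighted-≤ {(l , a) ∷ cs} {r = r} (0≤l ∷ ps) f≤r =
    subst (_ ℚ.≤_) (sym (ℚ.*-distribʳ-+ r l (∑ cs proj₁)))
      (ℚ.+-mono-≤ (ℚ.*-monoˡ-≤-nonNeg l {{nonNegative 0≤l}} (f≤r a)) (weighted-≤ ps f≤r))

-- Linearity along combinations of characteristic vectors; the hypothesis on x is pointwise
-- because points are functions and function extensionality is not available.
Linear : ∀ {n} → (Point n → ℚ) → Set
Linear {n} φ = ∀ (cs : List (ℚ × WeakOrder n)) (x : Point n) →
  (∀ i j → x i j ≡ weighted cs (λ W → charVec W i j)) →
  φ x ≡ weighted cs (λ W → φ (charVec W))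

module _ {n : ℕ} where

  coordinate-linear : ∀ (i j : Fin n) → Linear (λ x → x i j)
  coordinate-linear i j cs x x≡ = x≡ i j

  zero-linear : Linear {n} (λ _ → 0ℚ)
  zero-linear cs x x≡ = sym (weighted-zero cs)

  +-linear : ∀ {φ ψ : Point n → ℚ} → Linear φ → Linear ψ → Linear (λ x → φ x + ψ x)
  +-linear {φ} {ψ} φ-lin ψ-lin cs x x≡ =
    ≡.trans (cong₂ _+_ (φ-lin cs x x≡) (ψ-lin cs x x≡))
            (sym (weighted-+ cs (φ ∘ charVec) (ψ ∘ charVec)))

  neg-linear : ∀ {φ : Point n → ℚ} → Linear φ → Linear (λ x → - φ x)
  neg-linear {φ} φ-lin cs x x≡ =
    ≡.trans (cong -_ (φ-lin cs x x≡)) (sym (weighted-neg cs (φ ∘ charVec)))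

  −-linear : ∀ {φ ψ : Point n → ℚ} → Linear φ → Linear ψ → Linear (λ x → φ x - ψ x)
  −-linear φ-lin ψ-lin = +-linear φ-lin (neg-linear ψ-lin)

  if-linear : ∀ b {φ ψ : Point n → ℚ} → Linear φ → Linear ψ →
              Linear (λ x → if b then φ x else ψ x)
  if-linear true  φ-lin ψ-lin = φ-lin
  if-linear false φ-lin ψ-lin = ψ-lin

  ∑-linear : ∀ {A : Set} (xs : List A) {φ : A → Point n → ℚ} →
             (∀ a → Linear (φ a)) → Linear (λ x → ∑ xs (λ a → φ a x))
  ∑-linear []       φ-lin = zero-linear
  ∑-linear (a ∷ xs) φ-lin = +-linear (φ-lin a) (∑-linear xs φ-lin)

  ΣNc-linear : ∀ (i₁ i₂ : Fin n) {φ : Fin n → Point n → ℚ} →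
               (∀ j → Linear (φ j)) → Linear (λ x → ΣNc i₁ i₂ (λ j → φ j x))
  ΣNc-linear i₁ i₂ φ-lin =
    ∑-linear (allFin n) (λ j → if-linear (inNc i₁ i₂ j) (φ-lin j) zero-linear)

  lhs5-linear : ∀ (i₁ i₂ : Fin n) → Linear (lhs5 i₁ i₂)
  lhs5-linear i₁ i₂ =
    −-linear (−-linear
      (+-linear (coordinate-linear i₂ i₁)
                (ΣNc-linear i₁ i₂ (λ j →
                  +-linear (coordinate-linear i₁ j) (coordinate-linear j i₁))))
      (ΣNc-linear i₁ i₂ (λ j → ΣNc-linear i₁ i₂ (λ j' →
        if-linear ⌊ j ≟ j' ⌋ zero-linear (coordinate-linear j j')))))
      (ΣNc-linear i₁ i₂ (coordinate-linear i₂))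

  valid-from-vertices : ∀ {φ : Point n → ℚ} {r} → Linear φ → (∀ W → φ (charVec W) ℚ.≤ r) →
                        Valid (InWOPolytope n) φ r
  valid-from-vertices {φ} {r} φ-lin φ≤r x x∈P = begin
    φ x                                 ≡⟨ φ-lin comb x isComb ⟩
    weighted comb (λ W → φ (charVec W)) ≤⟨ weighted-≤ nonneg φ≤r ⟩
    ∑ comb proj₁ * r                    ≡⟨ cong (_* r) sumOne ⟩
    1ℚ * r                              ≡⟨ ℚ.*-identityˡ r ⟩
    r                                   ∎
    where
    open InWOPolytope x∈P
    open ℚ.≤-Reasoning

filterᵇ-∧ : ∀ {A : Set} (p q : A → Bool) xs →
            filterᵇ (λ a → p a ∧ q a) xs ≡ filterᵇ q (filterᵇ p xs)
filterᵇ-∧ p q []       = ≡.refl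
filterᵇ-∧ p q (x ∷ xs) with p x
... | false = filterᵇ-∧ p q xs
... | true with q x
...   | false = filterᵇ-∧ p q xs
...   | true  = cong (x ∷_) (filterᵇ-∧ p q xs)

length-filter-≢ : ∀ {A : Set} (_≟ᴬ_ : DecidableEquality A) {x : A} {xs} →
                  Unique xs → x ∈ xs → suc (length (filterᵇ (λ y → not ⌊ y ≟ᴬ x ⌋) xs)) ≡ length xs
length-filter-≢ _≟ᴬ_ {x} {y ∷ xs} (y∉xs ∷ xs-unique) x∈y∷xs with y ≟ᴬ x
... | yes ≡.refl =
  cong (suc ∘ length) (filter-all _ (All.map (λ x≢z → fromWitnessFalse (x≢z ∘ sym)) y∉xs))
... | no y≢x     = cong suc (length-filter-≢ _≟ᴬ_ xs-unique (x∈xs x∈y∷xs))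
  where
  x∈xs : x ∈ y ∷ xs → x ∈ xs
  x∈xs (here x≡y)  = contradiction (sym x≡y) y≢x
  x∈xs (there x∈) = x∈

Nᶜ : ∀ {n} → Fin n → Fin n → List (Fin n)
Nᶜ {n} i₁ i₂ = filterᵇ (inNc i₁ i₂) (allFin n)

Nᶜ-unique : ∀ {n} (i₁ i₂ : Fin n) → Unique (Nᶜ i₁ i₂)
Nᶜ-unique {n} i₁ i₂ = filter⁺ _ (allFin⁺ n)

length-Nᶜ : ∀ {n} {i₁ i₂ : Fin n} → i₁ ≢ i₂ → 2 ℕ.+ length (Nᶜ i₁ i₂) ≡ n
length-Nᶜ {n} {i₁} {i₂} i₁≢i₂ = begin
  2 ℕ.+ length (filterᵇ (λ j → ≢i₁ j ∧ ≢i₂ j) (allFin n))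
    ≡⟨ cong (λ js → 2 ℕ.+ length js) (filterᵇ-∧ ≢i₁ ≢i₂ (allFin n)) ⟩
  2 ℕ.+ length (filterᵇ ≢i₂ (filterᵇ ≢i₁ (allFin n)))
    ≡⟨ cong suc (length-filter-≢ _≟_ (filter⁺ _ (allFin⁺ n)) i₂∈) ⟩
  1 ℕ.+ length (filterᵇ ≢i₁ (allFin n))
    ≡⟨ length-filter-≢ _≟_ (allFin⁺ n) (∈-allFin i₁) ⟩
  length (allFin n)
    ≡⟨ length-tabulate (λ j → j) ⟩
  n ∎
  where
  open ≡-Reasoning
  ≢i₁ ≢i₂ : Fin n → Bool
  ≢i₁ j = not ⌊ j ≟ i₁ ⌋
  ≢i₂ j = not ⌊ j ≟ i₂ ⌋
  i₂∈ : i₂ ∈ filterᵇ ≢i₁ (allFin n)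
  i₂∈ = ∈-filter⁺ _ (∈-allFin i₂) (fromWitnessFalse (i₁≢i₂ ∘ sym))

ΣNc≡∑Nᶜ : ∀ {n} (i₁ i₂ : Fin n) f → ΣNc i₁ i₂ f ≡ ∑ (Nᶜ i₁ i₂) f
ΣNc≡∑Nᶜ {n} i₁ i₂ f = ∑-filterᵇ (inNc i₁ i₂) f (allFin n)

-- Off-diagonal sums

offDiagonal : ∀ {n} → Point n → Fin n → Fin n → ℚ
offDiagonal x j j' = if ⌊ j ≟ j' ⌋ then 0ℚ else x j j'

offDiagonalSum : ∀ {n} → Point n → List (Fin n) → ℚ
offDiagonalSum x js = ∑ js (λ j → ∑ js (offDiagonal x j))

offDiagonal-≢ : ∀ {n} (x : Point n) {k j} → k ≢ j → offDiagonal x k j ≡ x k j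
offDiagonal-≢ x {k} {j} k≢j with k ≟ j
... | yes k≡j = contradiction k≡j k≢j
... | no _    = ≡.refl

offDiagonal-diag : ∀ {n} (x : Point n) k → offDiagonal x k k ≡ 0ℚ
offDiagonal-diag x k with k ≟ k
... | yes _   = ≡.refl
... | no k≢k  = contradiction ≡.refl k≢k

offDiagonalSum-∷ : ∀ {n} (x : Point n) k js →
  offDiagonalSum x (k ∷ js)
    ≡ ∑ js (λ j → offDiagonal x k j + offDiagonal x j k) + offDiagonalSum x js
offDiagonalSum-∷ x k js = begin
  (offDiagonal x k k + row k) + ∑ js (λ j → offDiagonal x j k + row j)
    ≡⟨ cong₂ (λ d r → (d + row k) + r) (offDiagonal-diag x k)
             (∑-+ js (λ j → offDiagonal x j k) row) ⟩
  (0ℚ + row k) + (column k + offDiagonalSum x js)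
    ≡⟨ cong (_+ (column k + offDiagonalSum x js)) (ℚ.+-identityˡ (row k)) ⟩
  row k + (column k + offDiagonalSum x js)
    ≡⟨ sym (ℚ.+-assoc (row k) (column k) (offDiagonalSum x js)) ⟩
  (row k + column k) + offDiagonalSum x js
    ≡⟨ cong (_+ offDiagonalSum x js) (sym (∑-+ js (offDiagonal x k) (λ j → offDiagonal x j k))) ⟩
  ∑ js (λ j → offDiagonal x k j + offDiagonal x j k) + offDiagonalSum x js
    ∎
  where
  open ≡-Reasoning
  row column : Fin _ → ℚ
  row    i = ∑ js (offDiagonal x i)
  column i = ∑ js (λ j → offDiagonal x j i)

lhs5≡sums-over-Nᶜ : ∀ {n} (i₁ i₂ : Fin n) (x : Point n) →
  lhs5 i₁ i₂ x ≡ ((x i₂ i₁ + ∑ (Nᶜ i₁ i₂) (λ j → x i₁ j + x j i₁))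
                   - offDiagonalSum x (Nᶜ i₁ i₂))
                 - ∑ (Nᶜ i₁ i₂) (x i₂)
lhs5≡sums-over-Nᶜ i₁ i₂ x =
  cong₂ _-_ (cong₂ _-_ (cong (x i₂ i₁ +_) (ΣNc≡∑Nᶜ i₁ i₂ (λ j → x i₁ j + x j i₁))) nested)
            (ΣNc≡∑Nᶜ i₁ i₂ (x i₂))
  where
  nested : ΣNc i₁ i₂ (λ j → ΣNc i₁ i₂ (offDiagonal x j)) ≡ offDiagonalSum x (Nᶜ i₁ i₂)
  nested = ≡.trans (ΣNc≡∑Nᶜ i₁ i₂ (λ j → ΣNc i₁ i₂ (offDiagonal x j)))
                   (∑-cong (Nᶜ i₁ i₂) (λ j → ΣNc≡∑Nᶜ i₁ i₂ (offDiagonal x j)))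

module _ {n : ℕ} (x : Point n) (t : Fin n → Bool)
         (pair-≥ : ∀ k j → fromℕ (suc (bool→ℕ (t k) ℕ.* bool→ℕ (t j))) ℚ.≤ x k j + x j k) where

  row-pairs-≥ : ∀ {k js} → All (k ≢_) js →
    fromℕ (length js ℕ.+ bool→ℕ (t k) ℕ.* count t js)
      ℚ.≤ ∑ js (λ j → offDiagonal x k j + offDiagonal x j k)
  row-pairs-≥ {k} {js} k∉js = begin
    fromℕ (length js ℕ.+ tₖ ℕ.* count t js)
      ≡⟨ cong fromℕ (sym (≡.trans (sum-map-suc (λ j → tₖ ℕ.* bool→ℕ (t j)) js)
                                  (cong (length js ℕ.+_) (sum-map-*ˡ tₖ (λ j → bool→ℕ (t j)) js)))) ⟩
    fromℕ (sum (map (λ j → suc (tₖ ℕ.* bool→ℕ (t j))) js))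
      ≡⟨ sym (∑-fromℕ js (λ j → suc (tₖ ℕ.* bool→ℕ (t j)))) ⟩
    ∑ js (λ j → fromℕ (suc (tₖ ℕ.* bool→ℕ (t j))))
      ≤⟨ ∑-mono-≤ (All.map (λ {j} k≢j → subst (_ ℚ.≤_) (sym (off-diagonal k≢j)) (pair-≥ k j))
                           k∉js) ⟩
    ∑ js (λ j → offDiagonal x k j + offDiagonal x j k)
      ∎
    where
    open ℚ.≤-Reasoning
    tₖ : ℕ
    tₖ = bool→ℕ (t k)
    off-diagonal : ∀ {j} → k ≢ j → offDiagonal x k j + offDiagonal x j k ≡ x k j + x j k
    off-diagonal k≢j = cong₂ _+_ (offDiagonal-≢ x k≢j) (offDiagonal-≢ x (k≢j ∘ sym))

  offDiagonalSum-≥ : ∀ {js} → Unique js →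
                     fromℕ (length js C 2 ℕ.+ count t js C 2) ℚ.≤ offDiagonalSum x js
  offDiagonalSum-≥ {[]}     []                 = ℚ.≤-refl
  offDiagonalSum-≥ {k ∷ js} (k∉js ∷ js-unique) = begin
    fromℕ (suc l C 2 ℕ.+ (bool→ℕ (t k) ℕ.+ a) C 2)
      ≡⟨ cong fromℕ (pairs-∷ l (t k) a) ⟩
    fromℕ ((l ℕ.+ bool→ℕ (t k) ℕ.* a) ℕ.+ (l C 2 ℕ.+ a C 2))
      ≡⟨ fromℕ-+ (l ℕ.+ bool→ℕ (t k) ℕ.* a) (l C 2 ℕ.+ a C 2) ⟩
    fromℕ (l ℕ.+ bool→ℕ (t k) ℕ.* a) + fromℕ (l C 2 ℕ.+ a C 2)
      ≤⟨ ℚ.+-mono-≤ (row-pairs-≥ k∉js) (offDiagonalSum-≥ js-unique) ⟩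
    ∑ js (λ j → offDiagonal x k j + offDiagonal x j k) + offDiagonalSum x js
      ≡⟨ sym (offDiagonalSum-∷ x k js) ⟩
    offDiagonalSum x (k ∷ js)
      ∎
    where
    open ℚ.≤-Reasoning
    l : ℕ
    l = length js
    a : ℕ
    a = count t js

-- The bound at a vertex

module Vertex {n : ℕ} (W : WeakOrder n) (i₁ : Fin n) where

  x : Point n
  x = charVec W

  tied : Fin n → Bool
  tied j = rel W i₁ j ∧ rel W j i₁

  tied⇒≽ : ∀ {k j} → tied k ≡ true → tied j ≡ true → rel W k j ≡ true
  tied⇒≽ {k} {j} tₖ tⱼ = trans W k i₁ j (proj₂ (∧≡true⇒ tₖ)) (proj₁ (∧≡true⇒ tⱼ))

  x-nonNegative : ∀ i j → 0ℚ ℚ.≤ x i j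
  x-nonNegative i j =
    subst (0ℚ ℚ.≤_) (sym (bool→ℚ≡fromℕ (rel W i j))) (fromℕ-nonNegative (bool→ℕ (rel W i j)))

  1≤xₖⱼ+xⱼₖ : ∀ k j → fromℕ 1 ℚ.≤ x k j + x j k
  1≤xₖⱼ+xⱼₖ k j = subst (fromℕ 1 ℚ.≤_) (sym (bool→ℚ-+ (total W k j)))
    (fromℕ-mono-≤ {1} {suc (bool→ℕ (rel W k j ∧ rel W j k))} (s≤s z≤n))

  pair-≥ : ∀ k j → fromℕ (suc (bool→ℕ (tied k) ℕ.* bool→ℕ (tied j))) ℚ.≤ x k j + x j k
  pair-≥ k j with tied k in tₖ | tied j in tⱼ
  ... | true  | true  =
    ℚ.≤-reflexive (sym (cong₂ (λ u v → bool→ℚ u + bool→ℚ v)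
                              (tied⇒≽ tₖ tⱼ) (tied⇒≽ tⱼ tₖ)))
  ... | true  | false = 1≤xₖⱼ+xⱼₖ k j
  ... | false | _     = 1≤xₖⱼ+xⱼₖ k j

  i₂-entry-≥ : ∀ i₂ j → fromℕ (bool→ℕ (rel W i₂ i₁) ℕ.* bool→ℕ (tied j)) ℚ.≤ x i₂ j
  i₂-entry-≥ i₂ j with rel W i₂ i₁ in i₂≽i₁ | tied j in tⱼ
  ... | true  | true  =
    ℚ.≤-reflexive (cong bool→ℚ (sym (trans W i₂ i₁ j i₂≽i₁ (proj₁ (∧≡true⇒ tⱼ)))))
  ... | true  | false = x-nonNegative i₂ j
  ... | false | _     = x-nonNegative i₂ j

  i₂-row-≥ : ∀ i₂ js → fromℕ (bool→ℕ (rel W i₂ i₁) ℕ.* count tied js) ℚ.≤ ∑ js (x i₂)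
  i₂-row-≥ i₂ js = begin
    fromℕ (b ℕ.* count tied js)
      ≡⟨ cong fromℕ (sym (sum-map-*ˡ b (λ j → bool→ℕ (tied j)) js)) ⟩
    fromℕ (sum (map (λ j → b ℕ.* bool→ℕ (tied j)) js))
      ≡⟨ sym (∑-fromℕ js (λ j → b ℕ.* bool→ℕ (tied j))) ⟩
    ∑ js (λ j → fromℕ (b ℕ.* bool→ℕ (tied j)))
      ≤⟨ ∑-mono-≤ {xs = js} (All.tabulate (λ {j} _ → i₂-entry-≥ i₂ j)) ⟩
    ∑ js (x i₂)
      ∎
    where
    open ℚ.≤-Reasoning
    b : ℕ
    b = bool→ℕ (rel W i₂ i₁)

  i₁-sum : ∀ js → ∑ js (λ j → x i₁ j + x j i₁) ≡ fromℕ (length js ℕ.+ count tied js)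
  i₁-sum js = begin
    ∑ js (λ j → x i₁ j + x j i₁)
      ≡⟨ ∑-cong js (λ j → bool→ℚ-+ (total W i₁ j)) ⟩
    ∑ js (λ j → fromℕ (suc (bool→ℕ (tied j))))
      ≡⟨ ∑-fromℕ js (λ j → suc (bool→ℕ (tied j))) ⟩
    fromℕ (sum (map (λ j → suc (bool→ℕ (tied j))) js))
      ≡⟨ cong fromℕ (sum-map-suc (λ j → bool→ℕ (tied j)) js) ⟩
    fromℕ (length js ℕ.+ count tied js)
      ∎
    where open ≡-Reasoning

  lhs5-≤ : ∀ i₂ → 4 ≤ n → i₁ ≢ i₂ → lhs5 i₁ i₂ x ℚ.≤ rhs5 n
  lhs5-≤ i₂ 4≤n i₁≢i₂ = begin
    lhs5 i₁ i₂ x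
      ≡⟨ lhs5≡sums-over-Nᶜ i₁ i₂ x ⟩
    ((x i₂ i₁ + ∑ M (λ j → x i₁ j + x j i₁)) - offDiagonalSum x M) - ∑ M (x i₂)
      ≡⟨ cong₂ (λ u v → ((u + v) - offDiagonalSum x M) - ∑ M (x i₂))
               (bool→ℚ≡fromℕ (rel W i₂ i₁)) (i₁-sum M) ⟩
    ((fromℕ b + fromℕ (s ℕ.+ a)) - offDiagonalSum x M) - ∑ M (x i₂)
      ≤⟨ ℚ.+-mono-≤ (ℚ.+-monoʳ-≤ (fromℕ b + fromℕ (s ℕ.+ a))
                      (ℚ.neg-antimono-≤ (offDiagonalSum-≥ x tied pair-≥ (Nᶜ-unique i₁ i₂))))
                    (ℚ.neg-antimono-≤ (i₂-row-≥ i₂ M)) ⟩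
    ((fromℕ b + fromℕ (s ℕ.+ a)) - fromℕ (s C 2 ℕ.+ a C 2)) - fromℕ (b ℕ.* a)
      ≤⟨ vertex-value-≤ s (rel W i₂ i₁) a (length-Nᶜ i₁≢i₂) 4≤n ⟩
    rhs5 n
      ∎
    where
    open ℚ.≤-Reasoning
    M : List (Fin n)
    M = Nᶜ i₁ i₂
    s : ℕ
    s = length M
    a : ℕ
    a = count tied M
    b : ℕ
    b = bool→ℕ (rel W i₂ i₁)

theorem5 : (n : ℕ) → 4 ≤ n → (i₁ i₂ : Fin n) → i₁ ≢ i₂ →
    Valid (InWOPolytope n) (lhs5 i₁ i₂) (rhs5 n)
theorem5 n 4≤n i₁ i₂ i₁≢i₂ =
  valid-from-vertices (lhs5-linear i₁ i₂) (λ W → Vertex.lhs5-≤ W i₁ i₂ 4≤n i₁≢i₂)
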